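{- Let $G$ be a connected graph and let $(A,B)$ be a separation of the line graph $L(G)$. If $(A,B)$ is normalized, then the order of $(A,B)$ equals the order of its partner $[A',B']$.
   Context: Graphs are finite and may have loops and parallel edges. The line graph $L(G)$ is the simple graph with vertex set $E(G)$ in which two distinct edges are adjacent iff they share an end in $G$. For $v\in V(G)$, $\mathrm{cl}(v)$ is the clique of $L(G)$ consisting of the edges of $G$ incident with $v$. A separation of a graph $F$ is an ordered pair $(A,B)$ of edge-disjoint subgraphs with $A\cup B=F$; its order is $|V(A)\cap V(B)|$. It is normalized if every vertex of $V(A)\cap V(B)$ is adjacent to a vertex of $V(A)-V(B)$ and to a vertex of $V(B)-V(A)$. An edge-cut of $G$ is an ordered partition $[A',B']$ of $V(G)$ (parts may be empty); its order is the number of edges with one end in $A'$ and one in $B'$. The partner of a normalized separation $(A,B)$ of $L(G)$ is the edge-cut $[A',B']$ of $G$ where $A'$ is the union of the set of isolated vertices of $G$ and $\{v\in V(G):V(\mathrm{cl}(v))\subseteq V(A)\}$, and $B'=\{v\in V(G):V(\mathrm{cl}(v))\subseteq V(B)\}$. -}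

module Defs where

open import Data.Nat using (ℕ; zero; suc; _+_)
open import Data.Fin using (Fin; _≟_)
open import Data.Bool using (Bool; true; false; _∧_; _∨_; not; if_then_else_)
open import Data.List as List using (List; allFin; map)
open import Data.Bool.ListAction using (all; any)
open import Data.Nat.ListAction using (sum)
open import Data.Bool.Properties using (∧-comm)
open import Relation.Nullary.Decidable using (yes; no)
open import Relation.Binary.PropositionalEquality using (refl; cong; cong₂; sym)
open import Data.Vec using (Vec; lookup; tabulate)
open import Data.Fin.Subset using (Subset; _∈_; _∉_; _∩_; ∣_∣)
open import Data.Product using (Σ; _×_; ∃)
open import Data.Sum using (_⊎_)
open import Relation.Nullary.Decidable using (⌊_⌋)
open import Relation.Binary.PropositionalEquality using (_≡_)

-- Finite multigraphs (loops and parallel edges allowed):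
-- vertices Fin n, edges Fin m, each edge e has ends end₁ e and end₂ e
-- (a loop when they coincide).

record MultiGraph (n m : ℕ) : Set where
  field
    end₁ : Fin m → Fin n
    end₂ : Fin m → Fin n
open MultiGraph public

module _ {n m : ℕ} (G : MultiGraph n m) where

  data Walk : Fin n → Fin n → Set where
    stop : ∀ {u} → Walk u u
    step : ∀ {v} (e : Fin m) → Walk (end₂ G e) v → Walk (end₁ G e) v
    step' : ∀ {v} (e : Fin m) → Walk (end₁ G e) v → Walk (end₂ G e) v

  Connected : Set
  Connected = ∀ u v → Walk u v

  incident : Fin n → Fin m → Bool
  incident v e = ⌊ end₁ G e ≟ v ⌋ ∨ ⌊ end₂ G e ≟ v ⌋

  shareEnd : Fin m → Fin m → Bool
  shareEnd e f = any (λ v → incident v e ∧ incident v f) (allFin n)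

  isolated : Fin n → Bool
  isolated v = not (any (incident v) (allFin m))

record SimpleGraph (k : ℕ) : Set where
  field
    adj     : Fin k → Fin k → Bool
    irrefl  : ∀ x → adj x x ≡ false
    adj-sym : ∀ x y → adj x y ≡ adj y x
open SimpleGraph public

lineAdj : ∀ {n m} → MultiGraph n m → Fin m → Fin m → Bool
lineAdj G e f = not ⌊ e ≟ f ⌋ ∧ shareEnd G e f

private
  ≟-sym : ∀ {m} (e f : Fin m) → ⌊ e ≟ f ⌋ ≡ ⌊ f ≟ e ⌋
  ≟-sym e f with e ≟ f | f ≟ e
  ... | yes _ | yes _ = refl
  ... | no _  | no _  = refl
  ... | yes p | no q  with q (sym p)
  ... | ()
  ≟-sym e f | no p | yes q with p (sym q)
  ... | ()

  ≟-diag : ∀ {m} (e : Fin m) → ⌊ e ≟ e ⌋ ≡ true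
  ≟-diag e with e ≟ e
  ... | yes _ = refl
  ... | no p with p refl
  ... | ()

  any-cong : ∀ {A : Set} (p q : A → Bool) → (∀ x → p x ≡ q x) → (xs : List A) → any p xs ≡ any q xs
  any-cong p q h List.[] = refl
  any-cong p q h (x List.∷ xs) = cong₂ _∨_ (h x) (any-cong p q h xs)

lineGraph : ∀ {n m} → MultiGraph n m → SimpleGraph m
lineGraph {n} G = record
  { adj = lineAdj G
  ; irrefl = λ e → cong (λ b → not b ∧ shareEnd G e e) (≟-diag e)
  ; adj-sym = λ e f → cong₂ (λ b c → not b ∧ c) (≟-sym e f)
      (any-cong _ _ (λ v → ∧-comm (incident G v e) (incident G v f)) (allFin n))
  }

record Subgraph {k : ℕ} (F : SimpleGraph k) : Set where
  field
    V        : Subset k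
    E        : Fin k → Fin k → Bool
    E-sym    : ∀ x y → E x y ≡ E y x
    E-sub    : ∀ x y → E x y ≡ true → (adj F x y ≡ true) × (x ∈ V) × (y ∈ V)
open Subgraph public

record Separation {k : ℕ} (F : SimpleGraph k) : Set where
  field
    A B        : Subgraph F
    disjoint   : ∀ x y → E A x y ≡ true → E B x y ≡ false
    coverV     : ∀ x → x ∈ V A ⊎ x ∈ V B
    coverE     : ∀ x y → adj F x y ≡ true → E A x y ≡ true ⊎ E B x y ≡ true
open Separation public

order : ∀ {k} {F : SimpleGraph k} → Separation F → ℕ
order S = ∣ V (A S) ∩ V (B S) ∣

Normalized : ∀ {k} {F : SimpleGraph k} → Separation F → Set
Normalized {F = F} S =
  ∀ x → x ∈ V (A S) ∩ V (B S) →
    (∃ λ y → adj F x y ≡ true × y ∈ V (A S) × y ∉ V (B S)) ×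
    (∃ λ y → adj F x y ≡ true × y ∈ V (B S) × y ∉ V (A S))

record EdgeCut (n : ℕ) : Set where
  constructor [_,_]
  field
    A' B' : Subset n
open EdgeCut public

cutOrder : ∀ {n m} → MultiGraph n m → EdgeCut n → ℕ
cutOrder G [ X , Y ] =
  sum (map (λ e → if (lookup X (end₁ G e) ∧ lookup Y (end₂ G e))
                   ∨ (lookup Y (end₁ G e) ∧ lookup X (end₂ G e))
                  then 1 else 0) (allFin _))

module _ {n m : ℕ} (G : MultiGraph n m) where

  -- V(cl(v)) ⊆ X
  clIn : Subset m → Fin n → Bool
  clIn X v = all (λ e → not (incident G v e) ∨ lookup X e) (allFin m)

  partner : Separation (lineGraph G) → EdgeCut n
  partner S =
    [ tabulate (λ v → isolated G v ∨ clIn (V (A S)) v)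
    , tabulate (λ v → clIn (V (B S)) v) ]

-- An edge e of G lies in V(A) ∩ V(B) exactly when it joins a vertex of A'
-- to a vertex of B'; summing over the edges of G gives the theorem.  The
-- key observation is that as soon as one edge at v lies in A − B, the whole
-- clique cl(v) lies in A: an edge of cl(v) in B − A would be adjacent in L(G)
-- to one in A − B, and the edge joining them belongs to A or to B.  For
-- e ∈ V(A) ∩ V(B), normality yields neighbours f ∈ A − B and g ∈ B − A of e
-- in L(G); they meet e at different ends (otherwise g ∈ cl(v) ⊆ V(A)), so one
-- end of e is in A' and the other in B'.  Conversely an edge from A' to B'
-- lies in a clique contained in V(A) and in one contained in V(B).
module Submission where

open import Defs
open import Data.Nat using (ℕ; suc)
open import Data.Fin using (Fin; _≟_)
open import Data.Bool using (Bool; true; false; T; _∧_; _∨_; not; if_then_else_)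
open import Data.Bool.Properties using (T-≡; T-∧; T-∨; T-not-≡; ⇔→≡)
open import Data.Bool.ListAction using (all; any)
open import Data.Nat.ListAction using (sum)
open import Data.List as List using (allFin; map)
open import Data.List.Properties using (map-tabulate; map-cong)
open import Data.List.Membership.Propositional using (lose)
open import Data.List.Membership.Propositional.Properties using (∈-allFin)
open import Data.List.Relation.Unary.Any using (satisfied)
open import Data.List.Relation.Unary.Any.Properties using (any⁺; any⁻)
import Data.List.Relation.Unary.All as All
open import Data.List.Relation.Unary.All.Properties using (all⁺; all⁻)
open import Data.Vec as Vec using (lookup)
open import Data.Vec.Properties using ([]=⇒lookup; lookup⇒[]=; lookup∘tabulate)
open import Data.Fin.Subset using (Subset; _∈_; _∉_; _∩_; ∣_∣)
open import Data.Fin.Subset.Properties using (_∈?_; x∈p∩q⁺)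
open import Data.Product using (∃; _,_; proj₁; proj₂)
open import Data.Sum as Sum using (_⊎_; inj₁; inj₂)
open import Data.Empty using (⊥; ⊥-elim)
open import Function using (_∘_; _⇔_; mk⇔; Equivalence)
open import Relation.Nullary using (¬_; yes; no)
open import Relation.Nullary.Decidable using (⌊_⌋; toWitness; fromWitness)
open import Relation.Binary.PropositionalEquality
  using (_≡_; _≢_; refl; sym; trans; cong; subst; module ≡-Reasoning)

open Equivalence using (to; from)

indicator : Bool → ℕ
indicator b = if b then 1 else 0

∣p∣≡sum-indicator : ∀ {k} (p : Subset k) → ∣ p ∣ ≡ sum (map (indicator ∘ lookup p) (allFin k))
∣p∣≡sum-indicator p =
  trans (count p) (cong sum (sym (map-tabulate (λ i → i) (indicator ∘ lookup p))))
  where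
  count : ∀ {k} (p : Subset k) → ∣ p ∣ ≡ sum (List.tabulate (indicator ∘ lookup p))
  count Vec.[]          = refl
  count (true Vec.∷ p)  = cong suc (count p)
  count (false Vec.∷ p) = count p

∈⇔T-lookup : ∀ {k} {p : Subset k} {x} → x ∈ p ⇔ T (lookup p x)
∈⇔T-lookup {p = p} {x} = mk⇔ (from T-≡ ∘ []=⇒lookup) (lookup⇒[]= x p ∘ to T-≡)

∈⇔T⇒lookup≡ : ∀ {k} {p : Subset k} {x} {b : Bool} → (x ∈ p ⇔ T b) → lookup p x ≡ b
∈⇔T⇒lookup≡ x∈p⇔b = ⇔→≡ {z = true} (mk⇔
  (to T-≡ ∘ to x∈p⇔b ∘ from ∈⇔T-lookup ∘ from T-≡)
  (to T-≡ ∘ to ∈⇔T-lookup ∘ from x∈p⇔b ∘ from T-≡))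

T-not-∨ : ∀ {b c} → T (not b ∨ c) ⇔ (T b → T c)
T-not-∨ {true}  = mk⇔ (λ c _ → c) (λ f → f _)
T-not-∨ {false} = mk⇔ (λ _ ()) (λ _ → _)

T-any-allFin : ∀ {k} (p : Fin k → Bool) → T (any p (allFin k)) ⇔ ∃ (T ∘ p)
T-any-allFin {k} p = mk⇔
  (λ t → satisfied (any⁻ p (allFin k) t))
  (λ (i , pi) → any⁺ p (lose (∈-allFin i) pi))

T-all-allFin : ∀ {k} (p : Fin k → Bool) → T (all p (allFin k)) ⇔ (∀ i → T (p i))
T-all-allFin {k} p = mk⇔
  (λ t i → All.lookup (all⁺ p (allFin k) t) (∈-allFin i))
  (λ h → all⁻ p {allFin k} (All.tabulate (λ {i} _ → h i)))

module _ {k} {F : SimpleGraph k} where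

  swap : Separation F → Separation F
  swap S = record
    { A        = B S
    ; B        = A S
    ; disjoint = disjoint′
    ; coverV   = Sum.swap ∘ coverV S
    ; coverE   = λ x y → Sum.swap ∘ coverE S x y
    }
    where
    disjoint′ : ∀ x y → E (B S) x y ≡ true → E (A S) x y ≡ false
    disjoint′ x y eB with E (A S) x y in eA
    ... | true  = trans (sym eB) (disjoint S x y eA)
    ... | false = refl

  no-edge-between-sides : (S : Separation F) {x y : Fin k} → adj F x y ≡ true →
    x ∉ V (B S) → y ∉ V (A S) → ⊥
  no-edge-between-sides S {x} {y} xy x∉B y∉A with coverE S x y xy
  ... | inj₁ xy∈A = y∉A (proj₂ (proj₂ (E-sub (A S) x y xy∈A)))
  ... | inj₂ xy∈B = x∉B (proj₁ (proj₂ (E-sub (B S) x y xy∈B)))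

module _ {n m} (G : MultiGraph n m) where

  T-incident : ∀ {v e} → T (incident G v e) ⇔ (end₁ G e ≡ v ⊎ end₂ G e ≡ v)
  T-incident {v} {e} = mk⇔
    (Sum.map (toWitness {a? = end₁ G e ≟ v}) (toWitness {a? = end₂ G e ≟ v}) ∘ to T-∨)
    (from T-∨ ∘ Sum.map (fromWitness {a? = end₁ G e ≟ v}) (fromWitness {a? = end₂ G e ≟ v}))

  incident-end₁ : ∀ e → T (incident G (end₁ G e) e)
  incident-end₁ e = from T-incident (inj₁ refl)

  incident-end₂ : ∀ e → T (incident G (end₂ G e) e)
  incident-end₂ e = from T-incident (inj₂ refl)

  incident⇒¬isolated : ∀ {v e} → T (incident G v e) → ¬ T (isolated G v)
  incident⇒¬isolated {v} {e} ve iso =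
    subst T (to T-not-≡ iso) (from (T-any-allFin (incident G v)) (e , ve))

  incident⇒lineAdj : ∀ {v e f} → e ≢ f → T (incident G v e) → T (incident G v f) →
    lineAdj G e f ≡ true
  incident⇒lineAdj {v} {e} {f} e≢f ve vf with e ≟ f
  ... | yes e≡f = ⊥-elim (e≢f e≡f)
  ... | no _    = to T-≡ (from (T-any-allFin _) (v , from T-∧ (ve , vf)))

  lineAdj⇒incident-end : ∀ {e f} → lineAdj G e f ≡ true →
    T (incident G (end₁ G e) f) ⊎ T (incident G (end₂ G e) f)
  lineAdj⇒incident-end {e} {f} ef
    with to (T-any-allFin _) (proj₂ (to (T-∧ {not ⌊ e ≟ f ⌋}) (from T-≡ ef)))
  ... | v , ve∧vf with to T-∧ ve∧vf
  ...   | ve , vf with to (T-incident {v} {e}) ve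
  ...     | inj₁ refl = inj₁ vf
  ...     | inj₂ refl = inj₂ vf

  T-clIn : ∀ {X v} → T (clIn G X v) ⇔ (∀ e → T (incident G v e) → e ∈ X)
  T-clIn {X} {v} = mk⇔
    (λ t e → from ∈⇔T-lookup ∘ to T-not-∨ (to (T-all-allFin _) t e))
    (λ h → from (T-all-allFin _) (λ e → from T-not-∨ (to ∈⇔T-lookup ∘ h e)))

  crosses : EdgeCut n → Fin m → Bool
  crosses C e = (lookup (A' C) (end₁ G e) ∧ lookup (B' C) (end₂ G e))
              ∨ (lookup (B' C) (end₁ G e) ∧ lookup (A' C) (end₂ G e))

  cl⊆A : (S : Separation (lineGraph G)) {v : Fin n} {f : Fin m} →
    T (incident G v f) → f ∉ V (B S) → T (clIn G (V (A S)) v)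
  cl⊆A S {v} {f} vf f∉B = from T-clIn cl-in-A
    where
    cl-in-A : ∀ e → T (incident G v e) → e ∈ V (A S)
    cl-in-A e ve with e ∈? V (A S) | f ≟ e
    ... | yes e∈A | _        = e∈A
    ... | no e∉A  | yes refl = ⊥-elim (Sum.[ e∉A , f∉B ] (coverV S e))
    ... | no e∉A  | no f≢e   =
      ⊥-elim (no-edge-between-sides S (incident⇒lineAdj f≢e vf ve) f∉B e∉A)

  cl⊆B : (S : Separation (lineGraph G)) {v : Fin n} {g : Fin m} →
    T (incident G v g) → g ∉ V (A S) → T (clIn G (V (B S)) v)
  cl⊆B S = cl⊆A (swap S)

  module _ (S : Separation (lineGraph G)) {v : Fin n} where

    cl⊆A⇒∈A' : T (clIn G (V (A S)) v) → T (lookup (A' (partner G S)) v)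
    cl⊆A⇒∈A' c = subst T (sym (lookup∘tabulate _ v)) (from (T-∨ {isolated G v}) (inj₂ c))

    cl⊆B⇒∈B' : T (clIn G (V (B S)) v) → T (lookup (B' (partner G S)) v)
    cl⊆B⇒∈B' = subst T (sym (lookup∘tabulate _ v))

    ∈A'⇒cl⊆A : ∀ {e} → T (lookup (A' (partner G S)) v) → T (incident G v e) → e ∈ V (A S)
    ∈A'⇒cl⊆A {e} v∈A' ve with to T-∨ (subst T (lookup∘tabulate _ v) v∈A')
    ... | inj₁ isolated-v = ⊥-elim (incident⇒¬isolated ve isolated-v)
    ... | inj₂ c          = to T-clIn c e ve

    ∈B'⇒cl⊆B : ∀ {e} → T (lookup (B' (partner G S)) v) → T (incident G v e) → e ∈ V (B S)
    ∈B'⇒cl⊆B {e} v∈B' = to T-clIn (subst T (lookup∘tabulate _ v) v∈B') e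

  module _ (S : Separation (lineGraph G)) {e : Fin m} where

    crosses⇒shared : T (crosses (partner G S) e) → e ∈ V (A S) ∩ V (B S)
    crosses⇒shared c with to T-∨ c
    ... | inj₁ c₁ with to T-∧ c₁
    ...   | u∈A' , w∈B' =
      x∈p∩q⁺ (∈A'⇒cl⊆A S u∈A' (incident-end₁ e) , ∈B'⇒cl⊆B S w∈B' (incident-end₂ e))
    crosses⇒shared c | inj₂ c₂ with to T-∧ c₂
    ...   | u∈B' , w∈A' =
      x∈p∩q⁺ (∈A'⇒cl⊆A S w∈A' (incident-end₂ e) , ∈B'⇒cl⊆B S u∈B' (incident-end₁ e))

    shared⇒crosses : Normalized S → e ∈ V (A S) ∩ V (B S) → T (crosses (partner G S) e)
    shared⇒crosses N e∈A∩B with N e e∈A∩B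
    ... | (f , ef , _ , f∉B) , (g , eg , _ , g∉A)
      with lineAdj⇒incident-end ef | lineAdj⇒incident-end eg
    ... | inj₁ uf | inj₁ ug = ⊥-elim (g∉A (to T-clIn (cl⊆A S uf f∉B) g ug))
    ... | inj₂ wf | inj₂ wg = ⊥-elim (g∉A (to T-clIn (cl⊆A S wf f∉B) g wg))
    ... | inj₁ uf | inj₂ wg =
      from T-∨ (inj₁ (from T-∧ (cl⊆A⇒∈A' S (cl⊆A S uf f∉B) , cl⊆B⇒∈B' S (cl⊆B S wg g∉A))))
    ... | inj₂ wf | inj₁ ug =
      from (T-∨ {lookup (A' (partner G S)) (end₁ G e) ∧ lookup (B' (partner G S)) (end₂ G e)})
        (inj₂ (from T-∧ (cl⊆B⇒∈B' S (cl⊆B S ug g∉A) , cl⊆A⇒∈A' S (cl⊆A S wf f∉B))))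

lemma2p2 : ∀ {n m} (G : MultiGraph n m) → Connected G →
    (S : Separation (lineGraph G)) → Normalized S →
    order S ≡ cutOrder G (partner G S)
lemma2p2 {m = m} G _ S N = begin
  order S
    ≡⟨ ∣p∣≡sum-indicator (V (A S) ∩ V (B S)) ⟩
  sum (map (indicator ∘ lookup (V (A S) ∩ V (B S))) (allFin m))
    ≡⟨ cong sum (map-cong (cong indicator ∘ shared≡crosses) (allFin m)) ⟩
  sum (map (indicator ∘ crosses G (partner G S)) (allFin m))
    ≡⟨⟩
  cutOrder G (partner G S) ∎
  where
  open ≡-Reasoning
  shared≡crosses : ∀ e → lookup (V (A S) ∩ V (B S)) e ≡ crosses G (partner G S) e
  shared≡crosses e = ∈⇔T⇒lookup≡ (mk⇔ (shared⇒crosses G S N) (crosses⇒shared G S))
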